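{- Let $\mathbb{V}$ be a vector space of dimension $n$ over the field with $2$ elements, with basis $\{b_1,\dots,b_n\}$, and let $G(\mathbb{V})$ be its non-zero component graph. If $g$ is a non-trivial automorphism of $G(\mathbb{V})$, then there exist two distinct basis vectors $b_l,b_m$ such that $g(b_l)=b_m$.
   Context: The non-zero component graph $G(\mathbb{V})$ of a finite-dimensional vector space $\mathbb{V}$ with a fixed basis $\{b_1,\dots,b_n\}$ has as vertex set the non-zero vectors of $\mathbb{V}$, two distinct vertices being adjacent if and only if there is some $b_i$ having non-zero coefficient in the expansions of both vectors with respect to the basis. In particular the basis vectors $b_1,\dots,b_n$ are vertices of $G(\mathbb{V})$. -}

module Defs where

open import Data.Bool using (Bool; true; false; T; _∨_)
open import Data.Nat using (ℕ; suc)
open import Data.Empty using (⊥)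
open import Data.Fin using (Fin; zero; suc; _≟_)
open import Data.Vec using (Vec; []; _∷_; lookup; replicate)
open import Data.Product using (Σ; ∃; _×_; _,_; proj₁)
open import Relation.Binary.PropositionalEquality using (_≡_; _≢_)
open import Function.Bundles using (_↔_; Inverse)
open import Function.Base using (_∘_)

-- Vectors of 𝔽₂ⁿ are Vec Bool n (false = 0, true = 1), coordinates w.r.t.
-- the fixed standard basis b_1, …, b_n.

anyTrue : ∀ {n} → Vec Bool n → Bool
anyTrue []       = false
anyTrue (x ∷ xs) = x ∨ anyTrue xs

-- Vertices of G(V): non-zero vectors.  The side condition is T (anyTrue v),
-- which has at most one proof, so equality of vertices is equality of vectors.
Vertex : ℕ → Set
Vertex n = Σ (Vec Bool n) (λ v → T (anyTrue v))

Adj : ∀ {n} → Vertex n → Vertex n → Set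
Adj u v = u ≢ v × ∃ λ i → lookup (proj₁ u) i ≡ true × lookup (proj₁ v) i ≡ true

basisVec : ∀ {n} → Fin n → Vec Bool n
basisVec {suc n} zero    = true ∷ replicate n false
basisVec {suc n} (suc i) = false ∷ basisVec i

anyTrue-basis : ∀ {n} (i : Fin n) → T (anyTrue (basisVec i))
anyTrue-basis zero    = _
anyTrue-basis (suc i) = anyTrue-basis i

basis : ∀ {n} → Fin n → Vertex n
basis i = basisVec i , anyTrue-basis i

record Automorphism (n : ℕ) : Set where
  field
    perm     : Vertex n ↔ Vertex n
  open Inverse perm public using (to)
  field
    adj-pres : ∀ u v → Adj u v → Adj (to u) (to v)
    adj-refl : ∀ u v → Adj (to u) (to v) → Adj u v

NonTrivial : ∀ {n} → Automorphism n → Set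
NonTrivial {n} g = (∀ (v : Vertex n) → Automorphism.to g v ≡ v) → ⊥

module Submission where

-- The closed neighbourhood of a vertex consists of the vertices whose supports
-- meet its support.  Basis vectors have the smallest possible supports, and
-- they are exactly the vertices whose closed neighbourhood contains the closed
-- neighbourhood of no other vertex; this is a purely graph-theoretic property,
-- so every automorphism permutes the basis.  Moreover b_i lies in the closed
-- neighbourhood of v exactly when i lies in the support of v, so an
-- automorphism fixing every basis vector fixes every vertex.

open import Defs
open import Data.Nat using (ℕ)
open import Data.Fin using (Fin; zero; suc)
open import Data.Fin.Properties using (all?; ¬∀⟶∃¬)
open import Data.Bool using (Bool; true; false; T)
open import Data.Bool.Properties using (T-irrelevant; ⇔→≡) renaming (_≟_ to _≟ᵇ_)
open import Data.Vec using (Vec; _∷_; lookup; tabulate)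
open import Data.Vec.Properties using (≡-dec; lookup-replicate; tabulate∘lookup; tabulate-cong)
open import Data.Product using (∃; ∃₂; _×_; _,_; proj₁)
open import Data.Sum using (_⊎_; inj₁; inj₂)
open import Data.Empty using (⊥-elim)
open import Function.Base using (_∘_)
open import Function.Bundles using (Inverse; _⇔_; mk⇔; Equivalence)
open import Function.Properties.Equivalence using (⇔-setoid)
open import Level using (0ℓ)
open import Relation.Nullary using (Dec; yes; no)
open import Relation.Binary.PropositionalEquality
import Relation.Binary.Reasoning.Setoid as SetoidReasoning

private
  variable
    n : ℕ

_∈supp_ : Fin n → Vertex n → Set
i ∈supp v = lookup (proj₁ v) i ≡ true

Vertex-≡ : {u v : Vertex n} → proj₁ u ≡ proj₁ v → u ≡ v
Vertex-≡ {u = x , p} {v = .x , q} refl = cong (x ,_) (T-irrelevant p q)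

_≟ᵥ_ : (u v : Vertex n) → Dec (u ≡ v)
u ≟ᵥ v with ≡-dec _≟ᵇ_ (proj₁ u) (proj₁ v)
... | yes u≡v = yes (Vertex-≡ u≡v)
... | no  u≢v = no (u≢v ∘ cong proj₁)

Vertex-≡-bySupport : {u v : Vertex n} → (∀ i → i ∈supp u ⇔ i ∈supp v) → u ≡ v
Vertex-≡-bySupport {u = u} {v} same = Vertex-≡ (begin
  proj₁ u                     ≡⟨ tabulate∘lookup (proj₁ u) ⟨
  tabulate (lookup (proj₁ u)) ≡⟨ tabulate-cong (λ i → ⇔→≡ (same i)) ⟩
  tabulate (lookup (proj₁ v)) ≡⟨ tabulate∘lookup (proj₁ v) ⟩
  proj₁ v                     ∎)
  where open ≡-Reasoning

support-nonempty : (v : Vertex n) → ∃ (_∈supp v)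
support-nonempty (v , v≢0) = go v v≢0
  where
  go : (v : Vec Bool n) → T (anyTrue v) → ∃ λ i → lookup v i ≡ true
  go (true  ∷ _) _ = zero , refl
  go (false ∷ v) p = let i , e = go v p in suc i , e

∈supp-basis : (i j : Fin n) → j ∈supp basis i ⇔ i ≡ j
∈supp-basis i j = mk⇔ (only i j) λ { refl → self i }
  where
  self : (i : Fin n) → lookup (basisVec i) i ≡ true
  self zero    = refl
  self (suc i) = self i
  only : (i j : Fin n) → lookup (basisVec i) j ≡ true → i ≡ j
  only zero    zero    _ = refl
  only zero    (suc j) e with () ← trans (sym (lookup-replicate j false)) e
  only (suc i) (suc j) e = cong suc (only i j e)

SupportsMeet : Vertex n → Vertex n → Set
SupportsMeet u v = ∃ λ i → i ∈supp u × i ∈supp v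

AdjOrEq : Vertex n → Vertex n → Set
AdjOrEq u v = u ≡ v ⊎ Adj u v

adjOrEq⇔supportsMeet : {u v : Vertex n} → AdjOrEq u v ⇔ SupportsMeet u v
adjOrEq⇔supportsMeet {u = u} {v} = mk⇔ to from
  where
  to : AdjOrEq u v → SupportsMeet u v
  to (inj₁ refl)    = let i , i∈u = support-nonempty u in i , i∈u , i∈u
  to (inj₂ (_ , m)) = m
  from : SupportsMeet u v → AdjOrEq u v
  from m with u ≟ᵥ v
  ... | yes u≡v = inj₁ u≡v
  ... | no  u≢v = inj₂ (u≢v , m)

adjOrEq-basis⇔∈supp : (i : Fin n) {v : Vertex n} → AdjOrEq v (basis i) ⇔ i ∈supp v
adjOrEq-basis⇔∈supp i {v} = mk⇔ to from
  where
  to : AdjOrEq v (basis i) → i ∈supp v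
  to v~bᵢ with j , j∈v , j∈bᵢ ← Equivalence.to adjOrEq⇔supportsMeet v~bᵢ
             with refl ← Equivalence.to (∈supp-basis i j) j∈bᵢ = j∈v
  from : i ∈supp v → AdjOrEq v (basis i)
  from i∈v = Equivalence.from adjOrEq⇔supportsMeet (i , i∈v , Equivalence.from (∈supp-basis i i) refl)

_⊆ₙ_ : Vertex n → Vertex n → Set
u ⊆ₙ v = ∀ w → AdjOrEq u w → AdjOrEq v w

⊆ₙ⇒supp⊆ : {u v : Vertex n} → u ⊆ₙ v → ∀ i → i ∈supp u → i ∈supp v
⊆ₙ⇒supp⊆ u⊆v i =
  Equivalence.to (adjOrEq-basis⇔∈supp i) ∘ u⊆v (basis i) ∘ Equivalence.from (adjOrEq-basis⇔∈supp i)

∈supp⇒basis⊆ₙ : {i : Fin n} {v : Vertex n} → i ∈supp v → basis i ⊆ₙ v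
∈supp⇒basis⊆ₙ {i = i} i∈v w bᵢ~w
  with j , j∈bᵢ , j∈w ← Equivalence.to adjOrEq⇔supportsMeet bᵢ~w
  with refl ← Equivalence.to (∈supp-basis i j) j∈bᵢ
  = Equivalence.from adjOrEq⇔supportsMeet (i , i∈v , j∈w)

HasMinimalNbhd : Vertex n → Set
HasMinimalNbhd v = ∀ u → u ⊆ₙ v → u ≡ v

basis-hasMinimalNbhd : (i : Fin n) → HasMinimalNbhd (basis i)
basis-hasMinimalNbhd i u u⊆bᵢ = Vertex-≡-bySupport λ j → mk⇔ (⊆ₙ⇒supp⊆ u⊆bᵢ j) (onBasis j)
  where
  onBasis : ∀ j → j ∈supp basis i → j ∈supp u
  onBasis j j∈bᵢ
    with refl ← Equivalence.to (∈supp-basis i j) j∈bᵢ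
    with k , k∈u ← support-nonempty u
    with refl ← Equivalence.to (∈supp-basis i k) (⊆ₙ⇒supp⊆ u⊆bᵢ k k∈u) = k∈u

hasMinimalNbhd⇒basis : (v : Vertex n) → HasMinimalNbhd v → ∃ λ i → v ≡ basis i
hasMinimalNbhd⇒basis v minimal with i , i∈v ← support-nonempty v =
  i , sym (minimal (basis i) (∈supp⇒basis⊆ₙ i∈v))

module _ (g : Automorphism n) where
  open Automorphism g
  open Inverse perm using (from; strictlyInverseˡ; strictlyInverseʳ)

  adjOrEq-to⇔ : {u v : Vertex n} → AdjOrEq (to u) (to v) ⇔ AdjOrEq u v
  adjOrEq-to⇔ {u} {v} = mk⇔ reflect preserve
    where
    preserve : AdjOrEq u v → AdjOrEq (to u) (to v)
    preserve (inj₁ u≡v) = inj₁ (cong to u≡v)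
    preserve (inj₂ u~v) = inj₂ (adj-pres u v u~v)
    reflect : AdjOrEq (to u) (to v) → AdjOrEq u v
    reflect (inj₁ gu≡gv) = inj₁ (begin
      u           ≡⟨ strictlyInverseʳ u ⟨
      from (to u) ≡⟨ cong from gu≡gv ⟩
      from (to v) ≡⟨ strictlyInverseʳ v ⟩
      v           ∎)
      where open ≡-Reasoning
    reflect (inj₂ gu~gv) = inj₂ (adj-refl u v gu~gv)

  to-hasMinimalNbhd : {v : Vertex n} → HasMinimalNbhd v → HasMinimalNbhd (to v)
  to-hasMinimalNbhd {v} minimal u u⊆gv =
    trans (sym (strictlyInverseˡ u)) (cong to (minimal (from u) g⁻¹u⊆v))
    where
    g⁻¹u⊆v : from u ⊆ₙ v
    g⁻¹u⊆v w g⁻¹u~w = Equivalence.to adjOrEq-to⇔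
      (u⊆gv (to w) (subst (λ x → AdjOrEq x (to w)) (strictlyInverseˡ u) (Equivalence.from adjOrEq-to⇔ g⁻¹u~w)))

  fixes? : (i : Fin n) → Dec (to (basis i) ≡ basis i)
  fixes? i = to (basis i) ≟ᵥ basis i

  to-basis : (i : Fin n) → ∃ λ j → to (basis i) ≡ basis j
  to-basis i = hasMinimalNbhd⇒basis (to (basis i)) (to-hasMinimalNbhd (basis-hasMinimalNbhd i))

  fixesBasis⇒identity : (∀ i → to (basis i) ≡ basis i) → ∀ v → to v ≡ v
  fixesBasis⇒identity fixes v = Vertex-≡-bySupport λ i → begin
    i ∈supp to v                  ≈⟨ adjOrEq-basis⇔∈supp i ⟨
    AdjOrEq (to v) (basis i)      ≡⟨ cong (AdjOrEq (to v)) (fixes i) ⟨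
    AdjOrEq (to v) (to (basis i)) ≈⟨ adjOrEq-to⇔ ⟩
    AdjOrEq v (basis i)           ≈⟨ adjOrEq-basis⇔∈supp i ⟩
    i ∈supp v                     ∎
    where open SetoidReasoning (⇔-setoid 0ℓ)

mainTheorem2 : (n : ℕ) (g : Automorphism n) → NonTrivial g →
    ∃₂ λ (l m : Fin n) → l ≢ m × Automorphism.to g (basis l) ≡ basis m
mainTheorem2 n g nonTrivial with all? (fixes? g)
... | yes fixes = ⊥-elim (nonTrivial (fixesBasis⇒identity g fixes))
... | no ¬fixes
  with l , gbₗ≢bₗ ← ¬∀⟶∃¬ n _ (fixes? g) ¬fixes
  with m , gbₗ≡bₘ ← to-basis g l
  = l , m , (λ { refl → gbₗ≢bₗ gbₗ≡bₘ }) , gbₗ≡bₘ
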